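{- Let $k\ge4$ be an even integer, and let $A$ be a cyclically almost $k$-diagonal array of size $n>k$ in standard form, with extra filled position $(1,\ell)$. If $\gcd(n,k-1)=1$, then the following is a solution of $P(A)$: $R=(1,\dots,1)$, and $C\in\{ -1,1\}^n$ with $c_\ell=-1$ and $c_j=1$ for $j\neq\ell$.
   Context: Arrays are toroidal: an $n\times n$ array has rows and columns indexed modulo $n$ (representatives $1,\dots,n$). Each cell is filled or empty; $F(A)$ is the set of filled cells. For $(i,j)\in F(A)$: - the row successor $s_r((i,j))$ is $(i,j+k)$ with $k\ge1$ minimal such that $(i,j+k)\in F(A)$; - the column successor $s_c((i,j))$ is $(i+k,j)$ with $k\ge1$ minimal such that $(i+k,j)\in F(A)$. Given $R,C\in\{ -1,1\}^n$, the move function is $S_{R,C}((i,j))=s_c^{\,c_{j'}}((i,j'))$, where $(i,j')=s_r^{\,r_i}((i,j))$; exponent $-1$ means inverse. $R,C$ is a solution of $P(A)$ if $S_{R,C}$ is a single cycle on $F(A)$. Diagonals: $D_i=\{(i+t-1,t): t=1,\dots,n\}$, with row indices modulo $n$. A cyclically almost $k$-diagonal array of size $n>k$ is a square array whose filled cells are exactly the cells of $k$ diagonals consecutive modulo $n$, plus one extra filled cell lying in another diagonal. Standard form: such an array is in standard form if the totally filled diagonals are $D_1,\dots,D_k$ and the extra cell is $(1,\ell)$ with $2\le\ell\le n-k+1$. -}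

module Defs where

open import Data.Nat using (ℕ; zero; suc; _+_; _∸_; _<_; _≤_; NonZero)
open import Data.Nat.DivMod using (_mod_; _%_)
open import Data.Fin using (Fin; toℕ)
open import Data.Bool using (Bool; true; false; if_then_else_)
open import Data.Sign as Sg using (Sign)
open import Data.Product using (_×_; _,_; proj₁; proj₂; ∃; ∃-syntax)
open import Data.Sum using (_⊎_)
open import Function using (_∘_)
open import Relation.Binary.PropositionalEquality using (_≡_)

-- Conventions: an n×n toroidal array is a function Fin n → Fin n → Bool
-- (true = filled).  Paper row/column index r ∈ {1..n} corresponds to
-- the Fin n value r-1.  Exponent +1 is the sign +, exponent -1 is -.

Array : ℕ → Set
Array n = Fin n → Fin n → Bool

Cell : ℕ → Set
Cell n = Fin n × Fin n

Filled : ∀ {n} → Array n → Cell n → Set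
Filled A (i , j) = A i j ≡ true

module _ {n : ℕ} .{{_ : NonZero n}} where

  -- offset of the t-th cyclic step (1 ≤ t ≤ n) in direction s:
  -- forward (+) moves by t, backward (-) moves by -t ≡ n - t (mod n).
  offset : Sign → ℕ → ℕ
  offset Sg.+ t = t
  offset Sg.- t = n ∸ t

  -- first t ∈ {t₀, t₀+1, ..., t₀+fuel-1} with f t true; n if none.
  search : (ℕ → Bool) → ℕ → ℕ → ℕ
  search f t zero = n
  search f t (suc fuel) = if f t then t else search f (suc t) fuel

  -- the position reached from x by one step in direction s, skipping
  -- empty positions of the cyclic line `line` (minimal k ≥ 1).
  -- s = + gives the successor, s = - the inverse successor.
  lineStep : (Fin n → Bool) → Sign → Fin n → Fin n
  lineStep line s x =
    (toℕ x + offset s (search (λ t → line ((toℕ x + offset s t) mod n)) 1 n)) mod n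

  rowMove : Array n → Sign → Cell n → Cell n
  rowMove A e (i , j) = (i , lineStep (λ c → A i c) e j)

  colMove : Array n → Sign → Cell n → Cell n
  colMove A e (i , j) = (lineStep (λ r → A r j) e i , j)

  moveS : Array n → (Fin n → Sign) → (Fin n → Sign) → Cell n → Cell n
  moveS A R C (i , j) =
    let j' = proj₂ (rowMove A (R i) (i , j)) in colMove A (C j') (i , j')

  iterate : (Cell n → Cell n) → ℕ → Cell n → Cell n
  iterate f zero x = x
  iterate f (suc m) x = f (iterate f m x)

  IsSingleCycleOn : Array n → (Cell n → Cell n) → Set
  IsSingleCycleOn A f =
    ((x : Cell n) → Filled A x → Filled A (f x)) ×
    ((x y : Cell n) → Filled A x → Filled A y → ∃[ m ] iterate f m x ≡ y)

  IsSolution : Array n → (Fin n → Sign) → (Fin n → Sign) → Set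
  IsSolution A R C = IsSingleCycleOn A (moveS A R C)

  -- cell (i,j) (0-based) lies on diagonal D_d (1-based d):
  -- D_d = {(d+t-1, t)} i.e. row ≡ column + (d-1) (mod n).
  OnDiagonal : ℕ → Cell n → Set
  OnDiagonal d (i , j) = toℕ i ≡ (toℕ j + (d ∸ 1)) % n

  StandardForm : ℕ → ℕ → Array n → Set
  StandardForm k ℓ A =
    (2 ≤ ℓ) × (ℓ ≤ n ∸ k + 1) ×
    ((x : Cell n) → (Filled A x → (∃[ d ] (1 ≤ d × d ≤ k × OnDiagonal d x))
                                   ⊎ (toℕ (proj₁ x) ≡ 0 × toℕ (proj₂ x) ≡ ℓ ∸ 1))
                  × ((∃[ d ] (1 ≤ d × d ≤ k × OnDiagonal d x))
                       ⊎ (toℕ (proj₁ x) ≡ 0 × toℕ (proj₂ x) ≡ ℓ ∸ 1) → Filled A x))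

module Submission where

-- Idea (0-based indices, K = k - 1, m = ℓ - 1).  Rows are traversed to the
-- right; columns downward, except column m, which is traversed upward.
-- Below the main diagonal, S moves one column right along its diagonal; on
-- entering column m, diagonal δ ≥ 2 turns onto diagonal δ - 2 and diagonal 1
-- onto the extra cell, which leads back to the main diagonal.  On the main
-- diagonal S moves K columns left, except at two exits: column 0 climbs to the
-- top diagonal K, and column K + m leaves onto diagonal K - 1.  As K is odd,
-- the first exit runs down through all odd diagonals and the second through
-- all even ones; as K is a unit modulo n, listing the main diagonal by
-- multiples of K shows that these two excursions join its two arcs into a
-- single cycle through every filled cell.

open import Defs
open import Data.Nat using (ℕ; _≤_; _<_; _∸_; NonZero)
open import Data.Nat.Divisibility using (_∣_)
open import Data.Nat.GCD using (gcd)
open import Data.Fin using (Fin; toℕ)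
open import Data.Sign using (Sign)
open import Data.Sign as Sg using ()
open import Relation.Binary.PropositionalEquality using (_≡_; _≢_)

open import Data.Nat using (zero; suc; _+_; _*_; z≤n; s≤s; s≤s⁻¹; z<s; >-nonZero⁻¹; pred)
open import Data.Nat.Properties
open import Data.Nat.DivMod
open import Data.Nat.GCD using (module Bézout)
open import Data.Nat.Coprimality using (Coprime; coprime-Bézout; gcd≡1⇒coprime)
open import Data.Nat.Divisibility using (divides)
open import Data.Nat.Tactic.RingSolver using (solve-∀)
open import Data.Fin.Properties using (toℕ-fromℕ<; toℕ-injective; toℕ<n)
open import Data.Bool using (Bool; true; false)
open import Data.Bool.Properties using (¬-not)
open import Data.Product using (_×_; _,_; proj₁; proj₂; ∃-syntax)
open import Data.Sum using (_⊎_; inj₁; inj₂)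
open import Relation.Binary.PropositionalEquality
open import Relation.Nullary using (¬_; contradiction; yes; no)
open import Relation.Binary.Construct.Closure.ReflexiveTransitive using (Star; ε; _◅_; _◅◅_)

module Congruence (n : ℕ) .{{_ : NonZero n}} where

  infix 4 _≋_
  _≋_ : ℕ → ℕ → Set
  a ≋ b = a % n ≡ b % n

  ≡⇒≋ : ∀ {a b} → a ≡ b → a ≋ b
  ≡⇒≋ = cong (_% n)

  %-≋ : ∀ a → a % n ≋ a
  %-≋ a = m%n%n≡m%n a n

  +n-≋ : ∀ a → a + n ≋ a
  +n-≋ a = [m+n]%n≡m%n a n

  +*n-≋ : ∀ a q → a + q * n ≋ a
  +*n-≋ a q = [m+kn]%n≡m%n a q n

  wrap-≋ : ∀ {a b} → a ≡ b + n → a ≋ b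
  wrap-≋ {a} {b} eq = trans (≡⇒≋ eq) (+n-≋ b)

  +-≋ : ∀ {a a′ b b′} → a ≋ a′ → b ≋ b′ → a + b ≋ a′ + b′
  +-≋ {a} {a′} {b} {b′} p q = begin
    (a + b) % n               ≡⟨ %-distribˡ-+ a b n ⟩
    (a % n + b % n) % n       ≡⟨ cong₂ (λ x y → (x + y) % n) p q ⟩
    (a′ % n + b′ % n) % n     ≡⟨ %-distribˡ-+ a′ b′ n ⟨
    (a′ + b′) % n             ∎
    where open ≡-Reasoning

  *-≋ : ∀ {a a′ b b′} → a ≋ a′ → b ≋ b′ → a * b ≋ a′ * b′
  *-≋ {a} {a′} {b} {b′} p q = begin
    (a * b) % n               ≡⟨ %-distribˡ-* a b n ⟩
    (a % n * (b % n)) % n     ≡⟨ cong₂ (λ x y → (x * y) % n) p q ⟩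
    (a′ % n * (b′ % n)) % n   ≡⟨ %-distribˡ-* a′ b′ n ⟨
    (a′ * b′) % n             ∎
    where open ≡-Reasoning

  -- Addition cancels: adding c * (n - 1) turns "+ c" into "+ c * n".
  +-cancelʳ-≋ : ∀ {a b} c → a + c ≋ b + c → a ≋ b
  +-cancelʳ-≋ {a} {b} c eq = begin
    a % n                           ≡⟨ +*n-≋ a c ⟨
    (a + c * n) % n                 ≡⟨ ≡⇒≋ (shift a) ⟩
    (a + c + c * pred n) % n        ≡⟨ +-≋ eq refl ⟩
    (b + c + c * pred n) % n        ≡⟨ ≡⇒≋ (shift b) ⟨
    (b + c * n) % n                 ≡⟨ +*n-≋ b c ⟩
    b % n                           ∎
    where
      open ≡-Reasoning
      ring : ∀ x c p → x + c * suc p ≡ x + c + c * p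
      ring = solve-∀
      shift : ∀ x → x + c * n ≡ x + c + c * pred n
      shift x = trans (cong (λ y → x + c * y) (sym (suc-pred n))) (ring x c (pred n))

  ≋⇒≡ : ∀ {a b} → a < n → b < n → a ≋ b → a ≡ b
  ≋⇒≡ a<n b<n eq = trans (sym (m<n⇒m%n≡m a<n)) (trans eq (m<n⇒m%n≡m b<n))

  toℕ-mod : ∀ a → toℕ (a mod n) ≡ a % n
  toℕ-mod a = toℕ-fromℕ< (m%n<n a n)

  toℕ-mod-≋ : ∀ a → toℕ (a mod n) ≋ a
  toℕ-mod-≋ a = trans (≡⇒≋ (toℕ-mod a)) (%-≋ a)

  mod-cong : ∀ {a b} → a ≋ b → a mod n ≡ b mod n
  mod-cong {a} {b} eq = toℕ-injective (trans (toℕ-mod a) (trans eq (sym (toℕ-mod b))))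

  mod-toℕ : ∀ (x : Fin n) → x ≡ toℕ x mod n
  mod-toℕ x = toℕ-injective (trans (sym (m<n⇒m%n≡m (toℕ<n x))) (sym (toℕ-mod (toℕ x))))

search-first : ∀ {n} .{{_ : NonZero n}} (f : ℕ → Bool) t fuel d → d < fuel →
  (∀ e → e < d → f (t + e) ≡ false) → f (t + d) ≡ true → search {n} f t fuel ≡ t + d
search-first f t (suc fuel) zero _ _ hit with f t in ft
... | true  = sym (+-identityʳ t)
... | false = contradiction (trans (sym ft) (trans (cong f (sym (+-identityʳ t))) hit)) λ ()
search-first f t (suc fuel) (suc d) (s≤s d<fuel) miss hit with f t in ft
... | true  = contradiction (trans (sym ft) (trans (cong f (sym (+-identityʳ t))) (miss 0 z<s))) λ ()
... | false = trans (search-first f (suc t) fuel d d<fuel miss′ hit′) (sym (+-suc t d))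
  where
    miss′ : ∀ e → e < d → f (suc t + e) ≡ false
    miss′ e e<d = subst (λ x → f x ≡ false) (+-suc t e) (miss (suc e) (s≤s e<d))
    hit′ : f (suc t + d) ≡ true
    hit′ = subst (λ x → f x ≡ true) (+-suc t d) hit

lineStep-first : ∀ {n} .{{_ : NonZero n}} (line : Fin n → Bool) (s : Sign) a d → d < n →
  (∀ e → e < d → line ((a + offset s (suc e)) mod n) ≡ false) →
  line ((a + offset s (suc d)) mod n) ≡ true →
  lineStep line s (a mod n) ≡ (a + offset s (suc d)) mod n
lineStep-first {n} line s a d d<n miss hit =
  trans (cong (λ t → (toℕ (a mod n) + offset s t) mod n) (search-first f 1 n d d<n miss′ hit′))
        (shift (suc d))
  where
    open Congruence n
    f : ℕ → Bool
    f t = line ((toℕ (a mod n) + offset s t) mod n)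
    shift : ∀ t → (toℕ (a mod n) + offset s t) mod n ≡ (a + offset s t) mod n
    shift t = mod-cong (+-≋ (toℕ-mod-≋ a) refl)
    miss′ : ∀ e → e < d → f (suc e) ≡ false
    miss′ e e<d = trans (cong line (shift (suc e))) (miss e e<d)
    hit′ : f (suc d) ≡ true
    hit′ = trans (cong line (shift (suc d))) hit

module Paths {n : ℕ} .{{_ : NonZero n}} (f : Cell n → Cell n) (P : Cell n → Set) where

  Move : Cell n → Cell n → Set
  Move x y = f x ≡ y × P y

  Path : Cell n → Cell n → Set
  Path = Star Move

  iterate-shift : ∀ t x → iterate f t (f x) ≡ iterate f (suc t) x
  iterate-shift zero    x = refl
  iterate-shift (suc t) x = cong f (iterate-shift t x)

  path⇒iterate : ∀ {x y} → Path x y → ∃[ t ] iterate f t x ≡ y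
  path⇒iterate ε = 0 , refl
  path⇒iterate {x} ((fx≡y , _) ◅ rest) with path⇒iterate rest
  ... | t , eq = suc t , trans (sym (iterate-shift t x)) (trans (cong (iterate f t) fx≡y) eq)

module Units (n K : ℕ) .{{_ : NonZero n}} (coprime : Coprime n K) where
  open Congruence n

  inverse : ∃[ u ] u * K ≋ 1
  inverse with coprime-Bézout coprime
  ... | Bézout.-+ x y eq = y , trans (≡⇒≋ (sym eq)) (+*n-≋ 1 x)
  ... | Bézout.+- x y eq =
    pred n * y , trans (sym (+n-≋ _)) (trans (≡⇒≋ (begin
    pred n * y * K + n              ≡⟨ cong (pred n * y * K +_) (suc-pred n) ⟨
    pred n * y * K + suc (pred n)   ≡⟨ ring (pred n) y K ⟩
    1 + pred n * (1 + y * K)        ≡⟨ cong (λ z → 1 + pred n * z) eq ⟩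
    1 + pred n * (x * n)            ≡⟨ cong (1 +_) (*-assoc (pred n) x n) ⟨
    1 + pred n * x * n              ∎)) (+*n-≋ 1 (pred n * x)))
    where
      open ≡-Reasoning
      ring : ∀ p y K → p * y * K + suc p ≡ 1 + p * (1 + y * K)
      ring = solve-∀

  multiple-of : ∀ c → ∃[ q ] q < n × q * K ≋ c
  multiple-of c with inverse
  ... | u , uK≋1 = (c * u) % n , m%n<n (c * u) n , (begin
    ((c * u) % n * K) % n   ≡⟨ *-≋ (%-≋ (c * u)) refl ⟩
    (c * u * K) % n         ≡⟨ ≡⇒≋ (*-assoc c u K) ⟩
    (c * (u * K)) % n       ≡⟨ *-≋ {c} refl uK≋1 ⟩
    (c * 1) % n             ≡⟨ ≡⇒≋ (*-identityʳ c) ⟩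
    c % n                   ∎)
    where open ≡-Reasoning

  multiple-injective : ∀ {a b} → a < n → b < n → a * K ≋ b * K → a ≡ b
  multiple-injective {a} {b} a<n b<n eq with inverse
  ... | u , uK≋1 = ≋⇒≡ a<n b<n (trans (undo a) (trans (*-≋ eq refl) (sym (undo b))))
    where
      ring : ∀ x u K → x * (u * K) ≡ x * K * u
      ring = solve-∀
      undo : ∀ x → x ≋ x * K * u
      undo x = begin
        x % n               ≡⟨ ≡⇒≋ (*-identityʳ x) ⟨
        (x * 1) % n         ≡⟨ *-≋ {x} refl (sym uK≋1) ⟩
        (x * (u * K)) % n   ≡⟨ ≡⇒≋ (ring x u K) ⟩
        (x * K * u) % n     ∎
        where open ≡-Reasoning

-- The geometry of a cyclically almost k-diagonal array in standard form,
-- written with 0-based indices: k = K + 1 consecutive diagonals are filled,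
-- the extra filled cell is (0, m) with m = ℓ - 1 ≥ 1, and n = m + k + w.
-- A cell is addressed by natural-number coordinates taken modulo n; the cell
-- (a, b) lies o rows below the main diagonal when o + b ≡ a (mod n).
module Geometry {n : ℕ} .{{_ : NonZero n}} (m′ K w : ℕ)
  (size : n ≡ suc m′ + suc K + w)
  (A : Array n) (std : StandardForm (suc K) (suc (suc m′)) A)
  (R C : Fin n → Sign) (R-fwd : ∀ i → R i ≡ Sg.+)
  (C-up : ∀ j → toℕ j ≡ suc m′ → C j ≡ Sg.-) (C-down : ∀ j → toℕ j ≢ suc m′ → C j ≡ Sg.+)
  where

  open Congruence n

  m k gap : ℕ
  m = suc m′
  k = suc K
  -- number of empty cells between the last and the first filled diagonal
  -- along a row or column that avoids the extra cell
  gap = w + m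

  by-size : ∀ {x} → x ≡ suc m′ + suc K + w → x ≡ n
  by-size eq = trans eq (sym size)

  <-by-size : ∀ x y → x + suc y ≡ n → x < n
  <-by-size x y eq = subst (x <_) eq (m<m+n x z<s)

  K+gap : K + suc gap ≡ n
  K+gap = by-size (ring K w m′)
    where ring : ∀ K w m′ → K + suc (w + suc m′) ≡ suc m′ + suc K + w
          ring = solve-∀

  0<n : 0 < n
  0<n = >-nonZero⁻¹ n

  m<n : m < n
  m<n = <-by-size m (K + w) (by-size (ring m′ K w))
    where ring : ∀ m′ K w → suc m′ + suc (K + w) ≡ suc m′ + suc K + w
          ring = solve-∀

  K+m<n : K + m < n
  K+m<n = <-by-size (K + m) w (by-size (ring m′ K w))
    where ring : ∀ m′ K w → K + suc m′ + suc w ≡ suc m′ + suc K + w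
          ring = solve-∀

  k<n : k < n
  k<n = <-by-size k (m′ + w) (by-size (ring m′ K w))
    where ring : ∀ m′ K w → suc K + suc (m′ + w) ≡ suc m′ + suc K + w
          ring = solve-∀

  far-back : ∀ s → s ≤ gap → k ≤ n ∸ s
  far-back s s≤gap = m+n≤o⇒m≤o∸n k (≤-trans (+-monoʳ-≤ k s≤gap) (≤-reflexive (by-size (ring m′ K w))))
    where ring : ∀ m′ K w → suc K + (w + suc m′) ≡ suc m′ + suc K + w
          ring = solve-∀

  back-< : ∀ s → 0 < s → s ≤ n → n ∸ s < n
  back-< s 0<s s≤n = ∸-monoʳ-< 0<s s≤n

  at : ℕ → ℕ → Cell n
  at a b = (a mod n , b mod n)

  diag : ℕ → ℕ → Cell n
  diag δ c = at (δ + c) c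

  extra : Cell n
  extra = at 0 m

  at-cong : ∀ {a a′ b b′} → a ≋ a′ → b ≋ b′ → at a b ≡ at a′ b′
  at-cong p q = cong₂ _,_ (mod-cong p) (mod-cong q)

  toℕ-≋ : ∀ {a c} → toℕ (a mod n) ≡ c → a ≋ c
  toℕ-≋ {a} eq = trans (sym (toℕ-mod-≋ a)) (≡⇒≋ eq)

  OnFilledDiagonal IsExtra : Cell n → Set
  OnFilledDiagonal x = ∃[ d ] (1 ≤ d × d ≤ k × OnDiagonal d x)
  IsExtra x = toℕ (proj₁ x) ≡ 0 × toℕ (proj₂ x) ≡ m

  spec : ∀ x → (Filled A x → OnFilledDiagonal x ⊎ IsExtra x) ×
               (OnFilledDiagonal x ⊎ IsExtra x → Filled A x)
  spec = proj₂ (proj₂ std)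

  diag-filled : ∀ {a b} o → o < k → o + b ≋ a → Filled A (at a b)
  diag-filled {a} {b} o o<k eq = proj₂ (spec (at a b)) (inj₁ (suc o , s≤s z≤n , o<k , on-diag))
    where
      on-diag : toℕ (a mod n) ≡ (toℕ (b mod n) + o) % n
      on-diag = begin
        toℕ (a mod n)            ≡⟨ toℕ-mod a ⟩
        a % n                    ≡⟨ eq ⟨
        (o + b) % n              ≡⟨ ≡⇒≋ (+-comm o b) ⟩
        (b + o) % n              ≡⟨ +-≋ (toℕ-mod-≋ b) refl ⟨
        (toℕ (b mod n) + o) % n  ∎
        where open ≡-Reasoning

  extra-filled : ∀ {a b} → a ≋ 0 → b ≋ m → Filled A (at a b)
  extra-filled {a} {b} p q = proj₂ (spec (at a b)) (inj₂ (reduce p 0<n , reduce q m<n))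
    where
      reduce : ∀ {x c} → x ≋ c → c < n → toℕ (x mod n) ≡ c
      reduce {x} eq c<n = trans (toℕ-mod x) (trans eq (m<n⇒m%n≡m c<n))

  filled-offset : ∀ i j → Filled A (i , j) →
    (toℕ i ≡ 0 × toℕ j ≡ m) ⊎ ∃[ o ] o < k × o + toℕ j ≋ toℕ i
  filled-offset i j h with proj₁ (spec (i , j)) h
  ... | inj₂ is-extra = inj₁ is-extra
  ... | inj₁ (suc o , _ , o<k , on-diag) =
    inj₂ (o , o<k , trans (≡⇒≋ (+-comm o (toℕ j))) (trans (sym on-diag) (sym (m<n⇒m%n≡m (toℕ<n i)))))

  filled-cases : ∀ x → Filled A x → x ≡ extra ⊎ ∃[ o ] ∃[ c ] o < k × x ≡ diag o c
  filled-cases (i , j) h with filled-offset i j h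
  ... | inj₁ (i≡0 , j≡m) = inj₁ (trans (cong₂ _,_ (mod-toℕ i) (mod-toℕ j)) (at-cong (≡⇒≋ i≡0) (≡⇒≋ j≡m)))
  ... | inj₂ (o , o<k , eq) =
    inj₂ (o , toℕ j , o<k , trans (cong₂ _,_ (mod-toℕ i) (mod-toℕ j)) (at-cong (sym eq) refl))

  far-empty : ∀ {a b} o → k ≤ o → o < n → o + b ≋ a → ¬ (a ≋ 0 × b ≋ m) →
    A (a mod n) (b mod n) ≡ false
  far-empty {a} {b} o k≤o o<n eq not-extra = ¬-not filled⇒⊥
    where
      filled⇒⊥ : ¬ Filled A (at a b)
      filled⇒⊥ h with filled-offset (a mod n) (b mod n) h
      ... | inj₁ (i≡0 , j≡m) = not-extra (toℕ-≋ i≡0 , toℕ-≋ j≡m)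
      ... | inj₂ (o′ , o′<k , eq′) = <⇒≱ (subst (_< k) o′≡o o′<k) k≤o
        where
          same : o′ + b ≋ o + b
          same = trans (+-≋ {o′} refl (sym (toℕ-mod-≋ b))) (trans eq′ (trans (toℕ-mod-≋ a) (sym eq)))
          o′≡o : o′ ≡ o
          o′≡o = ≋⇒≡ (<-trans o′<k k<n) o<n (+-cancelʳ-≋ b same)

  S : Cell n → Cell n
  S = moveS A R C

  column : ℕ → Fin n → Bool
  column b r = A r (b mod n)

  move-at : ∀ {a b a′ b′} →
    lineStep (A (a mod n)) Sg.+ (b mod n) ≡ b′ mod n →
    lineStep (column b′) (C (b′ mod n)) (a mod n) ≡ a′ mod n →
    S (at a b) ≡ at a′ b′
  move-at {a} row col rewrite R-fwd (a mod n) | row | col = refl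

  C-down-at : ∀ {b} → ¬ b ≋ m → C (b mod n) ≡ Sg.+
  C-down-at {b} b≉m = C-down (b mod n) (λ eq → b≉m (toℕ-≋ eq))

  C-up-at : C (m mod n) ≡ Sg.-
  C-up-at = C-up (m mod n) (trans (toℕ-mod m) (m<n⇒m%n≡m m<n))

  gap<n : gap < n
  gap<n = <-by-size gap K (by-size (ring m′ K w))
    where ring : ∀ m′ K w → w + suc m′ + suc K ≡ suc m′ + suc K + w
          ring = solve-∀

  w<n : w < n
  w<n = ≤-<-trans (m≤m+n w m) gap<n

  -- the top diagonal meets row 0 in column m + w + 1
  top-right : K + (m + suc w) ≡ n
  top-right = by-size (ring m′ K w)
    where ring : ∀ m′ K w → K + (suc m′ + suc w) ≡ suc m′ + suc K + w
          ring = solve-∀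

  back-wrap : ∀ s x → s ≤ n → n ∸ s + (x + s) ≋ x
  back-wrap s x s≤n = wrap-≋ (begin
    n ∸ s + (x + s)   ≡⟨ ring (n ∸ s) x s ⟩
    x + (n ∸ s + s)   ≡⟨ cong (x +_) (m∸n+n≡m s≤n) ⟩
    x + n             ∎)
    where
      open ≡-Reasoning
      ring : ∀ y x s → y + (x + s) ≡ x + (y + s)
      ring = solve-∀

  -- from the top filled diagonal, gap + 1 further steps wrap to the main one
  past-gap : ∀ x → K + (x + suc gap) ≋ x
  past-gap x = wrap-≋ (trans (ring K x (suc gap)) (cong (x +_) K+gap))
    where ring : ∀ K x g → K + (x + g) ≡ x + (K + g)
          ring = solve-∀

  n∸-sum : ∀ {x s} → x + s ≡ n → n ∸ s ≡ x
  n∸-sum {x} {s} eq = trans (cong (_∸ s) (sym eq)) (m+n∸n≡m x s)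

  -- Offset of the cells strictly between the extra cell and the top
  -- diagonal, in row 0 and in column m.
  beyond : ℕ → ℕ
  beyond e = k + (w ∸ suc e)

  beyond-sum : ∀ e → e < w → beyond e + m + suc e ≡ n
  beyond-sum e e<w = by-size (begin
    k + (w ∸ suc e) + m + suc e   ≡⟨ ring k (w ∸ suc e) m (suc e) ⟩
    m + k + (w ∸ suc e + suc e)   ≡⟨ cong (m + k +_) (m∸n+n≡m e<w) ⟩
    m + k + w                     ∎)
    where
      open ≡-Reasoning
      ring : ∀ k x m s → k + x + m + s ≡ m + k + (x + s)
      ring = solve-∀

  beyond-far : ∀ e → k ≤ beyond e
  beyond-far e = m≤m+n k (w ∸ suc e)

  beyond-< : ∀ e → beyond e < n
  beyond-< e = ≤-<-trans (+-monoʳ-≤ k (m∸n≤m w (suc e))) (<-by-size (k + w) m′ (by-size (ring m′ K w)))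
    where ring : ∀ m′ K w → suc K + w + suc m′ ≡ suc m′ + suc K + w
          ring = solve-∀

  -- below the main diagonal the right neighbour is filled
  row-inner : ∀ {a} δ c → δ < k → suc δ + c ≋ a →
    lineStep (A (a mod n)) Sg.+ (c mod n) ≡ suc c mod n
  row-inner {a} δ c δ<k eq =
    trans (lineStep-first (A (a mod n)) Sg.+ c 0 0<n (λ _ ()) hit) (mod-cong (≡⇒≋ (+-comm c 1)))
    where
      ring : ∀ δ c → δ + (c + 1) ≡ suc δ + c
      ring = solve-∀
      hit : A (a mod n) ((c + 1) mod n) ≡ true
      hit = diag-filled δ δ<k (trans (≡⇒≋ (ring δ c)) eq)

  -- on the main diagonal outside row 0 the row wraps round to the top diagonal
  row-main : ∀ {a} c → c ≋ a → ¬ a ≋ 0 →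
    lineStep (A (a mod n)) Sg.+ (c mod n) ≡ (c + suc gap) mod n
  row-main {a} c eq a≉0 = lineStep-first (A (a mod n)) Sg.+ c gap gap<n miss hit
    where
      miss : ∀ e → e < gap → A (a mod n) ((c + suc e) mod n) ≡ false
      miss e e<gap = far-empty (n ∸ suc e) (far-back (suc e) e<gap) (back-< (suc e) z<s se≤n)
        (trans (back-wrap (suc e) c se≤n) eq) (λ (a≋0 , _) → a≉0 a≋0)
        where se≤n = <-trans e<gap gap<n
      hit : A (a mod n) ((c + suc gap) mod n) ≡ true
      hit = diag-filled K (n<1+n K) (trans (past-gap c) eq)

  -- in row 0 the main diagonal cell is followed by the extra cell
  row-origin : lineStep (A (0 mod n)) Sg.+ (0 mod n) ≡ m mod n
  row-origin = lineStep-first (A (0 mod n)) Sg.+ 0 m′ (<-trans (n<1+n m′) m<n) miss (extra-filled refl refl)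
    where
      miss : ∀ e → e < m′ → A (0 mod n) (suc e mod n) ≡ false
      miss e e<m′ = far-empty (n ∸ suc e) (far-back (suc e) se≤gap) (back-< (suc e) z<s se≤n)
        (back-wrap (suc e) 0 se≤n) (λ (_ , se≋m) → <⇒≢ (s≤s e<m′) (≋⇒≡ (<-trans (s≤s e<m′) m<n) m<n se≋m))
        where
          se≤gap : suc e ≤ gap
          se≤gap = ≤-trans (≤-trans e<m′ (n≤1+n m′)) (m≤n+m m w)
          se≤n = <⇒≤ (≤-<-trans se≤gap gap<n)

  -- from the extra cell the row wraps round to the top diagonal
  row-extra : lineStep (A (0 mod n)) Sg.+ (m mod n) ≡ (m + suc w) mod n
  row-extra = lineStep-first (A (0 mod n)) Sg.+ m w w<n miss hit
    where
      miss : ∀ e → e < w → A (0 mod n) ((m + suc e) mod n) ≡ false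
      miss e e<w = far-empty (beyond e) (beyond-far e) (beyond-< e)
        (wrap-≋ (trans (sym (+-assoc (beyond e) m (suc e))) (beyond-sum e e<w)))
        (λ (_ , m+se≋m) → m≢m+se (sym (≋⇒≡ m+se<n m<n m+se≋m)))
        where
          m+se<n : m + suc e < n
          m+se<n = ≤-<-trans (+-monoʳ-≤ m e<w) (<-by-size (m + w) K (by-size (ring m′ K w)))
            where ring : ∀ m′ K w → suc m′ + w + suc K ≡ suc m′ + suc K + w
                  ring = solve-∀
          m≢m+se : m ≢ m + suc e
          m≢m+se = <⇒≢ (m<m+n m z<s)
      hit : A (0 mod n) ((m + suc w) mod n) ≡ true
      hit = diag-filled K (n<1+n K) (wrap-≋ top-right)

  -- below a diagonal other than the top one the lower neighbour is filled
  col-down-inner : ∀ {a} δ c → suc δ < k → ¬ c ≋ m → δ + c ≋ a →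
    lineStep (column c) (C (c mod n)) (a mod n) ≡ (suc δ + c) mod n
  col-down-inner {a} δ c δ<K c≉m eq = begin
    lineStep (column c) (C (c mod n)) (a mod n)   ≡⟨ cong (λ s → lineStep (column c) s (a mod n)) (C-down-at c≉m) ⟩
    lineStep (column c) Sg.+ (a mod n)            ≡⟨ lineStep-first (column c) Sg.+ a 0 0<n (λ _ ()) hit ⟩
    (a + 1) mod n                                 ≡⟨ mod-cong (sym below) ⟩
    (suc δ + c) mod n                             ∎
    where
      open ≡-Reasoning
      below : suc δ + c ≋ a + 1
      below = trans (+-≋ {1} refl eq) (≡⇒≋ (+-comm 1 a))
      hit : column c ((a + 1) mod n) ≡ true
      hit = diag-filled (suc δ) δ<K below

  -- below the top diagonal the column wraps round to the main diagonal
  col-down-top : ∀ {a} c → ¬ c ≋ m → K + c ≋ a →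
    lineStep (column c) (C (c mod n)) (a mod n) ≡ c mod n
  col-down-top {a} c c≉m eq = begin
    lineStep (column c) (C (c mod n)) (a mod n)   ≡⟨ cong (λ s → lineStep (column c) s (a mod n)) (C-down-at c≉m) ⟩
    lineStep (column c) Sg.+ (a mod n)            ≡⟨ lineStep-first (column c) Sg.+ a gap gap<n miss hit ⟩
    (a + suc gap) mod n                           ≡⟨ mod-cong (sym wrapped) ⟩
    c mod n                                       ∎
    where
      open ≡-Reasoning
      ring : ∀ K c x → K + x + c ≡ K + c + x
      ring = solve-∀
      miss : ∀ e → e < gap → column c ((a + suc e) mod n) ≡ false
      miss e e<gap = far-empty (K + suc e) (subst (k ≤_) (sym (+-suc K e)) (m≤m+n k e))
        (<-≤-trans (+-monoʳ-< K (s≤s e<gap)) (≤-reflexive K+gap))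
        (trans (≡⇒≋ (ring K c (suc e))) (+-≋ eq refl)) (λ (_ , c≋m) → c≉m c≋m)
      wrapped : 0 + c ≋ a + suc gap
      wrapped = sym (trans (+-≋ (sym eq) refl) (trans (≡⇒≋ (+-assoc K c (suc gap))) (past-gap c)))
      hit : column c ((a + suc gap) mod n) ≡ true
      hit = diag-filled 0 z<s wrapped

  -- above a diagonal other than the main one the upper neighbour is filled
  col-up-inner : ∀ {a} δ → suc δ < k → suc δ + m ≋ a →
    lineStep (column m) (C (m mod n)) (a mod n) ≡ (δ + m) mod n
  col-up-inner {a} δ δ<K eq = begin
    lineStep (column m) (C (m mod n)) (a mod n)   ≡⟨ cong (λ s → lineStep (column m) s (a mod n)) C-up-at ⟩
    lineStep (column m) Sg.- (a mod n)            ≡⟨ lineStep-first (column m) Sg.- a 0 0<n (λ _ ()) hit ⟩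
    (a + (n ∸ 1)) mod n                           ≡⟨ mod-cong (sym above) ⟩
    (δ + m) mod n                                 ∎
    where
      open ≡-Reasoning
      ring : ∀ δ m x → suc δ + m + x ≡ δ + m + (1 + x)
      ring = solve-∀
      above : δ + m ≋ a + (n ∸ 1)
      above = sym (trans (+-≋ (sym eq) refl)
                (wrap-≋ (trans (ring δ m (n ∸ 1)) (cong (δ + m +_) (m+[n∸m]≡n 0<n)))))
      hit : column m ((a + (n ∸ 1)) mod n) ≡ true
      hit = diag-filled δ (<-trans (n<1+n δ) δ<K) above

  -- above the main diagonal, column m is empty up to the extra cell
  col-up-main : ∀ {a} → a ≋ m → lineStep (column m) (C (m mod n)) (a mod n) ≡ 0 mod n
  col-up-main {a} eq = begin
    lineStep (column m) (C (m mod n)) (a mod n)   ≡⟨ cong (λ s → lineStep (column m) s (a mod n)) C-up-at ⟩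
    lineStep (column m) Sg.- (a mod n)            ≡⟨ lineStep-first (column m) Sg.- a m′ (<-trans (n<1+n m′) m<n) miss hit ⟩
    (a + (n ∸ m)) mod n                           ≡⟨ mod-cong top ⟩
    0 mod n                                       ∎
    where
      open ≡-Reasoning
      top : a + (n ∸ m) ≋ 0
      top = trans (+-≋ eq refl) (wrap-≋ (m+[n∸m]≡n (<⇒≤ m<n)))
      hit : column m ((a + (n ∸ m)) mod n) ≡ true
      hit = extra-filled top refl
      miss : ∀ e → e < m′ → column m ((a + (n ∸ suc e)) mod n) ≡ false
      miss e e<m′ = far-empty (n ∸ suc e) (far-back (suc e) se≤gap) (back-< (suc e) z<s se≤n)
        (trans (≡⇒≋ (+-comm (n ∸ suc e) m)) (+-≋ (sym eq) refl)) not-extra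
        where
          se≤gap : suc e ≤ gap
          se≤gap = ≤-trans (≤-trans e<m′ (n≤1+n m′)) (m≤n+m m w)
          se≤n = <⇒≤ (≤-<-trans se≤gap gap<n)
          se≤m : suc e ≤ m
          se≤m = ≤-trans e<m′ (n≤1+n m′)
          rows-below : m ∸ suc e + n ≡ m + (n ∸ suc e)
          rows-below = begin
            m ∸ suc e + n                       ≡⟨ cong (m ∸ suc e +_) (m+[n∸m]≡n se≤n) ⟨
            m ∸ suc e + (suc e + (n ∸ suc e))   ≡⟨ +-assoc (m ∸ suc e) (suc e) (n ∸ suc e) ⟨
            m ∸ suc e + suc e + (n ∸ suc e)     ≡⟨ cong (_+ (n ∸ suc e)) (m∸n+n≡m se≤m) ⟩
            m + (n ∸ suc e)                     ∎
          not-extra : ¬ (a + (n ∸ suc e) ≋ 0 × m ≋ m)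
          not-extra (row≋0 , _) = <⇒≢ (m<n⇒0<n∸m (s≤s e<m′)) (sym (≋⇒≡ (≤-<-trans (m∸n≤m m (suc e)) m<n) 0<n
            (trans (sym (+n-≋ (m ∸ suc e))) (trans (≡⇒≋ rows-below) (trans (+-≋ (sym eq) refl) row≋0)))))

  -- above the extra cell, column m wraps round to the top diagonal
  col-up-extra : lineStep (column m) (C (m mod n)) (0 mod n) ≡ (K + m) mod n
  col-up-extra = begin
    lineStep (column m) (C (m mod n)) (0 mod n)   ≡⟨ cong (λ s → lineStep (column m) s (0 mod n)) C-up-at ⟩
    lineStep (column m) Sg.- (0 mod n)            ≡⟨ lineStep-first (column m) Sg.- 0 w w<n miss hit ⟩
    (n ∸ suc w) mod n                             ≡⟨ cong (_mod n) top ⟩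
    (K + m) mod n                                 ∎
    where
      open ≡-Reasoning
      ring : ∀ m′ K w → K + suc m′ + suc w ≡ suc m′ + suc K + w
      ring = solve-∀
      top : n ∸ suc w ≡ K + m
      top = n∸-sum (by-size (ring m′ K w))
      hit : column m ((n ∸ suc w) mod n) ≡ true
      hit = diag-filled K (n<1+n K) (≡⇒≋ (sym top))
      miss : ∀ e → e < w → column m ((n ∸ suc e) mod n) ≡ false
      miss e e<w = far-empty (beyond e) (beyond-far e) (beyond-< e)
        (≡⇒≋ (sym (n∸-sum (beyond-sum e e<w))))
        (λ (row≋0 , _) → <⇒≢ (m<n⇒0<n∸m se<n) (sym (≋⇒≡ (back-< (suc e) z<s (<⇒≤ se<n)) 0<n row≋0)))
        where se<n = ≤-<-trans e<w w<n

  move-along : ∀ δ c → suc δ < k → ¬ suc c ≋ m → S (diag (suc δ) c) ≡ diag (suc δ) (suc c)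
  move-along δ c δ<K sc≉m =
    move-at (row-inner δ c (<-trans (n<1+n δ) δ<K) refl) (col-down-inner δ (suc c) δ<K sc≉m (≡⇒≋ (+-suc δ c)))

  move-turn : ∀ δ → suc (suc δ) < k → S (diag (suc (suc δ)) m′) ≡ diag δ m
  move-turn δ δ<K =
    move-at (row-inner (suc δ) m′ (<-trans (n<1+n (suc δ)) δ<K) refl)
            (col-up-inner δ (<-trans (n<1+n (suc δ)) δ<K) (≡⇒≋ (+-suc (suc δ) m′)))

  move-to-extra : S (diag 1 m′) ≡ extra
  move-to-extra = move-at (row-inner 0 m′ z<s refl) (col-up-main refl)

  move-origin : S (diag 0 0) ≡ diag K m
  move-origin = move-at row-origin col-up-extra

  -- along the main diagonal elsewhere: from column c to column c - K
  move-main : ∀ c → ¬ c ≋ 0 → ¬ c ≋ K + m → S (diag 0 c) ≡ diag 0 (c + suc gap)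
  move-main c c≉0 c≉K+m = move-at (row-main c refl c≉0) (col-down-top (c + suc gap) not-m (past-gap c))
    where
      not-m : ¬ c + suc gap ≋ m
      not-m eq = c≉K+m (trans (sym (past-gap c)) (+-≋ {K} refl eq))

  move-pivot : ∀ δ → K ≡ suc δ → S (diag 0 (K + m)) ≡ diag δ m
  move-pivot δ K≡ = move-at row (col-up-inner δ (subst (_< k) K≡ (n<1+n K)) (≡⇒≋ (cong (_+ m) (sym K≡))))
    where
      ring : ∀ K m g → K + m + g ≡ m + (K + g)
      ring = solve-∀
      not-0 : ¬ K + m ≋ 0
      not-0 eq = 1+n≢0 (trans (sym (+-suc K m′)) (≋⇒≡ K+m<n 0<n eq))
      row : lineStep (A ((K + m) mod n)) Sg.+ ((K + m) mod n) ≡ m mod n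
      row = trans (row-main (K + m) refl not-0)
                  (mod-cong (wrap-≋ (trans (ring K m (suc gap)) (cong (m +_) K+gap))))

  move-extra : S extra ≡ diag 0 (m + suc w)
  move-extra = move-at row-extra (col-down-top (m + suc w) not-m (wrap-≋ top-right))
    where
      sw<n : suc w < n
      sw<n = ≤-<-trans (≤-trans (s≤s (m≤m+n w m′)) (≤-reflexive (sym (+-suc w m′)))) gap<n
      not-m : ¬ m + suc w ≋ m
      not-m eq = 1+n≢0 (≋⇒≡ sw<n 0<n (+-cancelʳ-≋ m (trans (≡⇒≋ (+-comm (suc w) m)) eq)))

-- For k = K + 1 even (K = 2r + 3) and gcd(n, K) = 1, the move function is a
-- single cycle on the filled cells.
module Cycle {n : ℕ} .{{_ : NonZero n}} (m′ r w : ℕ)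
  (size : n ≡ suc m′ + suc (suc (suc (suc (r * 2)))) + w)
  (A : Array n) (std : StandardForm (suc (suc (suc (suc (r * 2))))) (suc (suc m′)) A)
  (coprime : Coprime n (suc (suc (suc (r * 2)))))
  (R C : Fin n → Sign) (R-fwd : ∀ i → R i ≡ Sg.+)
  (C-up : ∀ j → toℕ j ≡ suc m′ → C j ≡ Sg.-) (C-down : ∀ j → toℕ j ≢ suc m′ → C j ≡ Sg.+)
  where

  K : ℕ
  K = suc (suc (suc (r * 2)))

  open Congruence n
  open Geometry m′ K w size A std R C R-fwd C-up C-down
  open Units n K coprime
  open Paths S (Filled A)

  last : ℕ
  last = pred n

  last<n : last < n
  last<n = subst (last <_) (suc-pred n) (n<1+n last)

  -- The main diagonal, its cells listed by multiples of K: the column of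
  -- Z q is q K.  Column m is p K.
  Z : ℕ → Cell n
  Z q = diag 0 (q * K)

  p : ℕ
  p = proj₁ (multiple-of m)

  p<n : p < n
  p<n = proj₁ (proj₂ (multiple-of m))

  pK≋m : p * K ≋ m
  pK≋m = proj₂ (proj₂ (multiple-of m))

  W : ℕ → ℕ → Cell n
  W δ t = diag δ (t + m)

  Z-p : W 0 0 ≡ Z p
  Z-p = at-cong (sym pK≋m) (sym pK≋m)

  Z-filled : ∀ q → Filled A (Z q)
  Z-filled q = diag-filled 0 z<s refl

  W-filled : ∀ δ t → δ < k → Filled A (W δ t)
  W-filled δ t δ<k = diag-filled δ δ<k refl

  K+m≋sp : K + m ≋ suc p * K
  K+m≋sp = +-≋ {K} refl (sym pK≋m)

  sp<n : suc p < n
  sp<n = ≤∧≢⇒< p<n sp≢n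
    where
      sp≢n : suc p ≢ n
      sp≢n sp≡n = 1+n≢0 (trans (sym (+-suc K m′)) (≋⇒≡ K+m<n 0<n (begin
        (K + m) % n       ≡⟨ K+m≋sp ⟩
        (suc p * K) % n   ≡⟨ ≡⇒≋ (cong (_* K) sp≡n) ⟩
        (n * K) % n       ≡⟨ ≡⇒≋ (*-comm n K) ⟩
        (K * n) % n       ≡⟨ +*n-≋ 0 K ⟩
        0 % n             ∎)))
        where open ≡-Reasoning

  -- along the main diagonal, the index decreases by one, except at the two
  -- exits q = 0 and q = p + 1
  Z-step : ∀ q → suc q < n → q ≢ p → S (Z (suc q)) ≡ Z q
  Z-step q sq<n q≢p = trans (move-main (suc q * K) not-0 not-pivot) (at-cong back back)
    where
      ring : ∀ q K g → K + q * K + g ≡ q * K + (K + g)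
      ring = solve-∀
      back : suc q * K + suc gap ≋ q * K
      back = wrap-≋ (trans (ring q K (suc gap)) (cong (q * K +_) K+gap))
      not-0 : ¬ suc q * K ≋ 0
      not-0 eq = 1+n≢0 (multiple-injective {suc q} {0} sq<n 0<n eq)
      not-pivot : ¬ suc q * K ≋ K + m
      not-pivot eq = q≢p (suc-injective (multiple-injective sq<n sp<n (trans eq K+m≋sp)))

  Z-exit : S (Z 0) ≡ W K 0
  Z-exit = move-origin

  Z-pivot : S (Z (suc p)) ≡ W (suc (suc (r * 2))) 0
  Z-pivot = trans (cong S (at-cong (sym K+m≋sp) (sym K+m≋sp))) (move-pivot (suc (suc (r * 2))) refl)

  extra-step : S extra ≡ Z last
  extra-step = trans move-extra (at-cong column-eq column-eq)
    where
      ring : ∀ m w K → m + suc w + K ≡ K + (m + suc w)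
      ring = solve-∀
      column-eq : m + suc w ≋ last * K
      column-eq = +-cancelʳ-≋ K (begin
        (m + suc w + K) % n    ≡⟨ ≡⇒≋ (trans (ring m w K) top-right) ⟩
        n % n                  ≡⟨ ≡⇒≋ (*-identityˡ n) ⟨
        (1 * n) % n            ≡⟨ +*n-≋ 0 1 ⟩
        0 % n                  ≡⟨ +*n-≋ 0 K ⟨
        (K * n) % n            ≡⟨ ≡⇒≋ (cong (K *_) (suc-pred n)) ⟨
        (K * suc last) % n     ≡⟨ ≡⇒≋ (trans (*-suc K last) (+-comm K (K * last))) ⟩
        (K * last + K) % n     ≡⟨ ≡⇒≋ (cong (_+ K) (*-comm K last)) ⟩
        (last * K + K) % n     ∎)
        where open ≡-Reasoning

  -- the column before m on a diagonal is the last index t = n - 1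
  last-column : last + m ≋ m′
  last-column = wrap-≋ (trans (+-suc last m′) (trans (cong (_+ m′) (suc-pred n)) (+-comm n m′)))

  W-step : ∀ δ t → suc δ < k → suc t < n → S (W (suc δ) t) ≡ W (suc δ) (suc t)
  W-step δ t δ<K st<n = move-along δ (t + m) δ<K not-m
    where
      not-m : ¬ suc t + m ≋ m
      not-m eq = 1+n≢0 (≋⇒≡ st<n 0<n (+-cancelʳ-≋ m eq))

  W-turn : ∀ δ → suc (suc δ) < k → S (W (suc (suc δ)) last) ≡ W δ 0
  W-turn δ δ<K = trans (cong S (at-cong (+-≋ {suc (suc δ)} refl last-column) last-column)) (move-turn δ δ<K)

  W-exit : S (W 1 last) ≡ extra
  W-exit = trans (cong S (at-cong (+-≋ {1} refl last-column) last-column)) move-to-extra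

  walk-along : ∀ δ d a → suc δ < k → d + a < n → Path (W (suc δ) a) (W (suc δ) (d + a))
  walk-along δ zero    a δ<K _     = ε
  walk-along δ (suc d) a δ<K bound =
    walk-along δ d a δ<K (<-trans (n<1+n (d + a)) bound) ◅◅
    (W-step δ (d + a) δ<K bound , W-filled (suc δ) (suc (d + a)) δ<K) ◅ ε

  to-end : ∀ δ t → suc δ < k → t < n → Path (W (suc δ) t) (W (suc δ) last)
  to-end δ t δ<K t<n = subst (λ u → Path (W (suc δ) t) (W (suc δ) u)) length
    (walk-along δ (last ∸ t) t δ<K (subst (_< n) (sym length) last<n))
    where length = m∸n+n≡m (<⇒≤pred t<n)

  from-start : ∀ δ t → suc δ < k → t < n → Path (W (suc δ) 0) (W (suc δ) t)
  from-start δ t δ<K t<n = subst (λ u → Path (W (suc δ) 0) (W (suc δ) u)) (+-identityʳ t)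
    (walk-along δ t 0 δ<K (subst (_< n) (sym (+-identityʳ t)) t<n))

  Z-walk : ∀ d a → d + a < n → (∀ q → a ≤ q → q < d + a → q ≢ p) → Path (Z (d + a)) (Z a)
  Z-walk zero    a _     _     = ε
  Z-walk (suc d) a bound avoid =
    (Z-step (d + a) bound (avoid (d + a) (m≤n+m a d) (n<1+n (d + a))) , Z-filled (d + a)) ◅
    Z-walk d a (<-trans (n<1+n (d + a)) bound) (λ q a≤q q< → avoid q a≤q (<-trans q< (n<1+n (d + a))))

  Z-down : ∀ {a b} → a ≤ b → b < n → (∀ q → a ≤ q → q < b → q ≢ p) → Path (Z b) (Z a)
  Z-down {a} {b} a≤b b<n avoid = subst (λ x → Path (Z x) (Z a)) length
    (Z-walk (b ∸ a) a (subst (_< n) (sym length) b<n) (λ q a≤q q< → avoid q a≤q (subst (q <_) length q<)))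
    where length = m∸n+n≡m a≤b

  rung : ℕ → ℕ → ℕ
  rung b j = b + j * 2

  parity : ∀ δ → ∃[ j ] (δ ≡ rung 0 j ⊎ δ ≡ rung 1 j)
  parity zero = 0 , inj₁ refl
  parity (suc δ) with parity δ
  ... | j , inj₁ even = j , inj₂ (cong suc even)
  ... | j , inj₂ odd  = suc j , inj₁ (cong suc odd)

  rung-bound : ∀ b j → rung b j < k → j ≤ suc r
  rung-bound b j bound = s≤s⁻¹ (*-cancelʳ-< 2 j (suc (suc r)) (≤-<-trans (m≤n+m (j * 2) b) bound))

  rung-split : ∀ b {j x} → j ≤ x → (x ∸ j) * 2 + rung b j ≡ rung b x
  rung-split b {j} {x} j≤x = trans (ring (x ∸ j) j b) (cong (λ y → b + y * 2) (m∸n+n≡m j≤x))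
    where ring : ∀ d j b → d * 2 + (b + j * 2) ≡ b + (d + j) * 2
          ring = solve-∀

  -- descending two diagonals at a time, each time walking a whole diagonal
  ladder : ∀ i δ → i * 2 + δ < k → Path (W (i * 2 + δ) 0) (W δ 0)
  ladder zero    δ _     = ε
  ladder (suc i) δ bound =
    to-end (suc (i * 2 + δ)) 0 bound 0<n ◅◅ (W-turn (i * 2 + δ) bound , W-filled _ 0 lower) ◅ ladder i δ lower
    where lower = <-trans (n<1+n _) (<-trans (n<1+n _) bound)

  enter : ∀ b j → j ≤ suc r → rung b (suc r) < k → Path (W (rung b (suc r)) 0) (W (rung b j) 0)
  enter b j j≤ top<k = subst (λ δ → Path (W δ 0) (W (rung b j) 0)) (rung-split b j≤)
    (ladder (suc r ∸ j) (rung b j) (subst (_< k) (sym (rung-split b j≤)) top<k))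

  leave-odd : ∀ j t → rung 1 j < k → t < n → Path (W (rung 1 j) t) extra
  leave-odd zero    t bound t<n = to-end 0 t bound t<n ◅◅ (W-exit , extra-filled refl refl) ◅ ε
  leave-odd (suc j) t bound t<n =
    to-end (suc (rung 1 j)) t bound t<n ◅◅ (W-turn (rung 1 j) bound , W-filled _ 0 lower) ◅ leave-odd j 0 lower 0<n
    where lower = <-trans (n<1+n _) (<-trans (n<1+n _) bound)

  leave-even : ∀ j t → rung 0 (suc j) < k → t < n → Path (W (rung 0 (suc j)) t) (Z p)
  leave-even zero    t bound t<n = to-end 1 t bound t<n ◅◅ (trans (W-turn 0 bound) Z-p , Z-filled p) ◅ ε
  leave-even (suc j) t bound t<n =
    to-end (suc (rung 0 (suc j))) t bound t<n ◅◅ (W-turn (rung 0 (suc j)) bound , W-filled _ 0 lower) ◅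
    leave-even j 0 lower 0<n
    where lower = <-trans (n<1+n _) (<-trans (n<1+n _) bound)

  below-pivot : ∀ {a b} → a ≤ b → b ≤ p → Path (Z b) (Z a)
  below-pivot a≤b b≤p = Z-down a≤b (≤-<-trans b≤p p<n) (λ q _ q<b → <⇒≢ (<-≤-trans q<b b≤p))

  above-pivot : ∀ {a b} → p < a → a ≤ b → b < n → Path (Z b) (Z a)
  above-pivot p<a a≤b b<n = Z-down a≤b b<n (λ q a≤q _ q≡p → <⇒≢ (<-≤-trans p<a a≤q) (sym q≡p))

  -- The cycle through Z 0: up the top diagonal and down the odd diagonals
  -- to the extra cell, down the main diagonal to index p + 1, down the even
  -- diagonals to index p, and down the main diagonal to index 0.
  odd-arc : Path (Z 0) extra
  odd-arc = (Z-exit , W-filled K 0 (n<1+n K)) ◅ leave-odd (suc r) 0 (n<1+n K) 0<n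

  upper-arc : ∀ {q} → p < q → q < n → Path extra (Z q)
  upper-arc p<q q<n = (extra-step , Z-filled last) ◅ above-pivot p<q (<⇒≤pred q<n) last<n

  even-top<k : rung 0 (suc r) < k
  even-top<k = <-trans (n<1+n (rung 0 (suc r))) (n<1+n K)

  even-arc : Path (Z (suc p)) (Z p)
  even-arc = (Z-pivot , W-filled _ 0 even-top<k) ◅ leave-even r 0 even-top<k 0<n

  to-pivot : Path (Z 0) (Z (suc p))
  to-pivot = odd-arc ◅◅ upper-arc (n<1+n p) sp<n

  from-pivot : Path (Z (suc p)) (Z 0)
  from-pivot = even-arc ◅◅ below-pivot z≤n ≤-refl

  Linked : Cell n → Set
  Linked x = Path (Z 0) x × Path x (Z 0)

  extra-linked : Linked extra
  extra-linked = odd-arc , upper-arc (n<1+n p) sp<n ◅◅ from-pivot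

  Z-linked : ∀ q → q < n → Linked (Z q)
  Z-linked q q<n with q ≤? p
  ... | yes q≤p = to-pivot ◅◅ even-arc ◅◅ below-pivot q≤p ≤-refl , below-pivot z≤n q≤p
  ... | no  q≰p = odd-arc ◅◅ upper-arc (≰⇒> q≰p) q<n , above-pivot (n<1+n p) (≰⇒> q≰p) q<n ◅◅ from-pivot

  W-linked : ∀ δ t → suc δ < k → t < n → Linked (W (suc δ) t)
  W-linked δ t δ<K t<n with parity (suc δ)
  ... | j , inj₂ odd = subst (λ d → Linked (W d t)) (sym odd) (into , out)
    where
      bound = subst (_< k) odd δ<K
      into : Path (Z 0) (W (rung 1 j) t)
      into = (Z-exit , W-filled K 0 (n<1+n K)) ◅
             enter 1 j (rung-bound 1 j bound) (n<1+n K) ◅◅ from-start (j * 2) t bound t<n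
      out : Path (W (rung 1 j) t) (Z 0)
      out = leave-odd j t bound t<n ◅◅ upper-arc (n<1+n p) sp<n ◅◅ from-pivot
  ... | suc j , inj₁ even = subst (λ d → Linked (W d t)) (sym even) (into , out)
    where
      bound = subst (_< k) even δ<K
      into : Path (Z 0) (W (rung 0 (suc j)) t)
      into = to-pivot ◅◅ (Z-pivot , W-filled _ 0 even-top<k) ◅
             enter 0 (suc j) (rung-bound 0 (suc j) bound) even-top<k ◅◅ from-start (suc (j * 2)) t bound t<n
      out : Path (W (rung 0 (suc j)) t) (Z 0)
      out = leave-even j t bound t<n ◅◅ below-pivot z≤n ≤-refl

  column-index : ∀ c → ∃[ t ] t < n × t + m ≋ c
  column-index c = (c + (n ∸ m)) % n , m%n<n _ n , (begin
    ((c + (n ∸ m)) % n + m) % n   ≡⟨ +-≋ (%-≋ (c + (n ∸ m))) refl ⟩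
    (c + (n ∸ m) + m) % n         ≡⟨ wrap-≋ (trans (+-assoc c (n ∸ m) m) (cong (c +_) (m∸n+n≡m (<⇒≤ m<n)))) ⟩
    c % n                         ∎)
    where open ≡-Reasoning

  linked : ∀ x → Filled A x → Linked x
  linked x h with filled-cases x h
  ... | inj₁ x≡extra = subst Linked (sym x≡extra) extra-linked
  ... | inj₂ (zero , c , _ , x≡) with multiple-of c
  ...   | q , q<n , qK≋c = subst Linked (sym (trans x≡ (at-cong (sym qK≋c) (sym qK≋c)))) (Z-linked q q<n)
  linked x h | inj₂ (suc δ , c , δ<K , x≡) with column-index c
  ...   | t , t<n , t+m≋c =
    subst Linked (sym (trans x≡ (at-cong (+-≋ {suc δ} refl (sym t+m≋c)) (sym t+m≋c)))) (W-linked δ t δ<K t<n)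

  -- S maps filled cells to filled cells: the first step of the path back
  -- to Z 0 lands on a filled cell.
  S-filled : ∀ x → Filled A x → Filled A (S x)
  S-filled x h with proj₂ (linked x h)
  ... | ε = subst (Filled A) (sym Z-exit) (W-filled K 0 (n<1+n K))
  ... | (Sx≡y , y-filled) ◅ _ = subst (Filled A) (sym Sx≡y) y-filled

  solution : IsSolution A R C
  solution = S-filled , λ x y hx hy → path⇒iterate (proj₂ (linked x hx) ◅◅ proj₁ (linked y hy))

size-split : ∀ {n k m′} → k < n → suc (suc m′) ≤ n ∸ k + 1 → n ≡ suc m′ + k + (n ∸ (suc m′ + k))
size-split {n} {k} {m′} k<n ℓ≤ = sym (m+[n∸m]≡n (m≤o∸n⇒m+n≤o (suc m′) (<⇒≤ k<n) m≤n∸k))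
  where
    m≤n∸k : suc m′ ≤ n ∸ k
    m≤n∸k = s≤s⁻¹ (subst (suc (suc m′) ≤_) (+-comm (n ∸ k) 1) ℓ≤)

-- k = 2 (r + 2) is even and at least 4, and ℓ = m′ + 2 ≥ 2.
proposition5p13 : (k n ℓ : ℕ) .{{_ : NonZero n}} → 4 ≤ k → 2 ∣ k → k < n →
    (A : Array n) → StandardForm k ℓ A → gcd n (k ∸ 1) ≡ 1 →
    (R C : Fin n → Sign) → (∀ i → R i ≡ Sg.+) →
    (∀ j → toℕ j ≡ ℓ ∸ 1 → C j ≡ Sg.-) → (∀ j → toℕ j ≢ ℓ ∸ 1 → C j ≡ Sg.+) →
    IsSolution A R C
proposition5p13 .(0 * 2) n ℓ () (divides zero refl) _ _ _ _ _ _ _ _ _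
proposition5p13 .(1 * 2) n ℓ (s≤s (s≤s ())) (divides 1 refl) _ _ _ _ _ _ _ _ _
proposition5p13 .(suc (suc r) * 2) n .(suc (suc m′)) _ (divides (suc (suc r)) refl) k<n
  A std@(s≤s (s≤s (z≤n {m′})) , ℓ≤ , _) gcd≡1 R C R-fwd C-up C-down =
  Cycle.solution m′ r (n ∸ (suc m′ + suc (suc r) * 2)) (size-split k<n ℓ≤) A std
    (gcd≡1⇒coprime gcd≡1) R C R-fwd C-up C-down
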